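{- Let $L$ be a pretransitive normal modal logic and $m=\mathrm{tr}(L)$. Then for every modal formula $\varphi$, $$\varphi\in L[1]\iff \Diamond^{\leq m}\Box^{\leq m}\varphi\in L.$$
   Context: Modal formulas are built from variables $p_1,p_2,\dots$, $\bot,\top$, Boolean connectives and unary $\Diamond$; $\Box\varphi=\neg\Diamond\neg\varphi$, $\Diamond^0\varphi=\varphi$, $\Diamond^{i+1}\varphi=\Diamond\Diamond^i\varphi$, $\Box^0\varphi=\varphi$, $\Box^{i+1}\varphi=\Box\Box^i\varphi$, $\Diamond^{\le m}\varphi=\bigvee_{i=0}^m\Diamond^i\varphi$, $\Box^{\le m}\varphi=\bigwedge_{i=0}^m\Box^i\varphi$. A (normal propositional modal) logic is a set of formulas containing all propositional tautologies, $\neg\Diamond\bot$ and $\Diamond(p_1\vee p_2)\to\Diamond p_1\vee\Diamond p_2$, closed under modus ponens, substitution, and the monotonicity rule (from $\varphi\to\psi$ infer $\Diamond\varphi\to\Diamond\psi$). $L+\Phi$ is the smallest logic containing $L\cup\Phi$. A logic $L$ is pretransitive if it contains $\Diamond^{m+1}p\to\Diamond^{\le m}p$ for some $m\ge 0$; $\mathrm{tr}(L)$ is the least such $m$. Formulas $B_h(m)$: $B_1(m)=p_1\to\Box^{\le m}\Diamond^{\le m}p_1$, $B_{h+1}(m)=p_{h+1}\to\Box^{\le m}(\Diamond^{\le m}p_{h+1}\vee B_h(m))$. For pretransitive $L$, $L[h]=L+\{B_h(\mathrm{tr}(L))\}$. -}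

module Defs where

open import Data.Nat using (ℕ; zero; suc; _≤_)
open import Data.Bool using (Bool; true; false; not; _∧_; _∨_)
open import Relation.Binary.PropositionalEquality using (_≡_)
open import Data.Product using (_×_)

-- Modal formulas; variable  var n  stands for p_{n+1}.
data Fm : Set where
  var  : ℕ → Fm
  ⊥'   : Fm
  ⊤'   : Fm
  ¬'_  : Fm → Fm
  _∧'_ : Fm → Fm → Fm
  _∨'_ : Fm → Fm → Fm
  _⇒_  : Fm → Fm → Fm
  ◇_   : Fm → Fm

infixr 4 _⇒_
infixl 5 _∨'_
infixl 6 _∧'_
infix 7 ¬'_ ◇_ □_

□_ : Fm → Fm
□ φ = ¬' (◇ (¬' φ))

◇^ : ℕ → Fm → Fm
◇^ zero φ = φ
◇^ (suc i) φ = ◇ (◇^ i φ)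

□^ : ℕ → Fm → Fm
□^ zero φ = φ
□^ (suc i) φ = □ (□^ i φ)

◇≤ : ℕ → Fm → Fm
◇≤ zero φ = φ
◇≤ (suc m) φ = ◇≤ m φ ∨' ◇^ (suc m) φ

□≤ : ℕ → Fm → Fm
□≤ zero φ = φ
□≤ (suc m) φ = □≤ m φ ∧' □^ (suc m) φ

p₁ p₂ : Fm
p₁ = var 0
p₂ = var 1

subst : (ℕ → Fm) → Fm → Fm
subst σ (var n) = σ n
subst σ ⊥' = ⊥'
subst σ ⊤' = ⊤'
subst σ (¬' φ) = ¬' subst σ φ
subst σ (φ ∧' ψ) = subst σ φ ∧' subst σ ψ
subst σ (φ ∨' ψ) = subst σ φ ∨' subst σ ψ
subst σ (φ ⇒ ψ) = subst σ φ ⇒ subst σ ψ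
subst σ (◇ φ) = ◇ subst σ φ

eval : (ℕ → Bool) → (Fm → Bool) → Fm → Bool
eval a b (var n) = a n
eval a b ⊥' = false
eval a b ⊤' = true
eval a b (¬' φ) = not (eval a b φ)
eval a b (φ ∧' ψ) = eval a b φ ∧ eval a b ψ
eval a b (φ ∨' ψ) = eval a b φ ∨ eval a b ψ
eval a b (φ ⇒ ψ) = not (eval a b φ) ∨ eval a b ψ
eval a b (◇ φ) = b φ

-- Propositional tautology (substitution instance of a classical tautology)
Tautology : Fm → Set
Tautology φ = ∀ (a : ℕ → Bool) (b : Fm → Bool) → eval a b φ ≡ true

FmSet : Set₁
FmSet = Fm → Set

record IsLogic (L : FmSet) : Set where
  field
    taut  : ∀ {φ} → Tautology φ → L φ
    dia⊥  : L (¬' (◇ ⊥'))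
    dia∨  : L (◇ (p₁ ∨' p₂) ⇒ (◇ p₁ ∨' ◇ p₂))
    mp    : ∀ {φ ψ} → L φ → L (φ ⇒ ψ) → L ψ
    sub   : ∀ {φ} (σ : ℕ → Fm) → L φ → L (subst σ φ)
    mono  : ∀ {φ ψ} → L (φ ⇒ ψ) → L (◇ φ ⇒ ◇ ψ)

data _⊕_ (L Φ : FmSet) : FmSet where
  inL   : ∀ {φ} → L φ → (L ⊕ Φ) φ
  inΦ   : ∀ {φ} → Φ φ → (L ⊕ Φ) φ
  taut  : ∀ {φ} → Tautology φ → (L ⊕ Φ) φ
  dia⊥  : (L ⊕ Φ) (¬' (◇ ⊥'))
  dia∨  : (L ⊕ Φ) (◇ (p₁ ∨' p₂) ⇒ (◇ p₁ ∨' ◇ p₂))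
  mp    : ∀ {φ ψ} → (L ⊕ Φ) φ → (L ⊕ Φ) (φ ⇒ ψ) → (L ⊕ Φ) ψ
  sub   : ∀ {φ} (σ : ℕ → Fm) → (L ⊕ Φ) φ → (L ⊕ Φ) (subst σ φ)
  mono  : ∀ {φ ψ} → (L ⊕ Φ) (φ ⇒ ψ) → (L ⊕ Φ) (◇ φ ⇒ ◇ ψ)

PT : ℕ → Fm
PT m = ◇^ (suc m) p₁ ⇒ ◇≤ m p₁

IsTr : FmSet → ℕ → Set
IsTr L m = L (PT m) × (∀ k → L (PT k) → m ≤ k)

B : ℕ → ℕ → Fm
B zero m = ⊤'   -- unused index (h starts at 1)
B (suc zero) m = p₁ ⇒ □≤ m (◇≤ m p₁)
B (suc (suc h)) m =
  var (suc h) ⇒ □≤ m (◇≤ m (var (suc h)) ∨' B (suc h) m)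

⟦_⟧ : Fm → FmSet
⟦ φ ⟧ ψ = ψ ≡ φ

_[_]at_ : FmSet → ℕ → ℕ → FmSet
L [ h ]at m = L ⊕ ⟦ B h m ⟧

-- In a logic containing ◇^{m+1} p → ◇^{≤m} p, the pair □* = □^{≤m}, ◇* = ◇^{≤m} is a normal
-- modality satisfying ◇*◇* p → ◇* p, i.e. an S4 modality, and B₁(m) is the Brouwer axiom
-- p → □*◇* p for it. The formulas φ with ◇*□*φ ∈ L contain L and B₁(m) and are closed under
-- modus ponens, substitution and monotonicity, so they include L[1]. Conversely, in L[1] the
-- instance ¬φ → □*◇*¬φ of B₁(m) is incompatible with ◇*□*φ, which therefore yields φ.
module Submission where

open import Data.Bool using (Bool; true; false; not; _∧_; _∨_; T)
open import Data.Bool.Properties using (T-∧; T-≡)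
open import Data.Fin using (Fin; zero; suc)
open import Data.Nat using (ℕ; zero; suc; _+_)
open import Data.Product using (_×_; _,_; proj₁; proj₂)
open import Data.Vec using (Vec; []; _∷_; lookup; map)
open import Data.Vec.Properties using (lookup-map)
open import Function using (_∘_; id)
open import Function.Bundles using (Equivalence)
open import Relation.Binary.Bundles using (Preorder)
open import Relation.Binary.PropositionalEquality
  using (_≡_; refl; sym; trans; cong; cong₂; isEquivalence) renaming (subst to ≡-subst)
import Relation.Binary.Reasoning.Preorder as PreorderReasoning

open import Defs

variable
  n : ℕ

infixr 4 _⇒ₚ_
infixl 5 _∨ₚ_
infixl 6 _∧ₚ_
infix 7 ¬ₚ_

data Schema (n : ℕ) : Set where
  `_             : Fin n → Schema n
  ⊥ₚ             : Schema n
  ¬ₚ_            : Schema n → Schema n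
  _∧ₚ_ _∨ₚ_ _⇒ₚ_ : Schema n → Schema n → Schema n

x₀ : Schema (1 + n)
x₀ = ` zero

x₁ : Schema (2 + n)
x₁ = ` suc zero

x₂ : Schema (3 + n)
x₂ = ` suc (suc zero)

x₃ : Schema (4 + n)
x₃ = ` suc (suc (suc zero))

_⟨_⟩ : Schema n → Vec Fm n → Fm
(` i) ⟨ ρ ⟩    = lookup ρ i
⊥ₚ ⟨ ρ ⟩       = ⊥'
(¬ₚ P) ⟨ ρ ⟩   = ¬' (P ⟨ ρ ⟩)
(P ∧ₚ Q) ⟨ ρ ⟩ = P ⟨ ρ ⟩ ∧' Q ⟨ ρ ⟩
(P ∨ₚ Q) ⟨ ρ ⟩ = P ⟨ ρ ⟩ ∨' Q ⟨ ρ ⟩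
(P ⇒ₚ Q) ⟨ ρ ⟩ = P ⟨ ρ ⟩ ⇒ Q ⟨ ρ ⟩

⟦_⟧ₚ : Schema n → Vec Bool n → Bool
⟦ ` i ⟧ₚ v    = lookup v i
⟦ ⊥ₚ ⟧ₚ v     = false
⟦ ¬ₚ P ⟧ₚ v   = not (⟦ P ⟧ₚ v)
⟦ P ∧ₚ Q ⟧ₚ v = ⟦ P ⟧ₚ v ∧ ⟦ Q ⟧ₚ v
⟦ P ∨ₚ Q ⟧ₚ v = ⟦ P ⟧ₚ v ∨ ⟦ Q ⟧ₚ v
⟦ P ⇒ₚ Q ⟧ₚ v = not (⟦ P ⟧ₚ v) ∨ ⟦ Q ⟧ₚ v

allValuations : (n : ℕ) → (Vec Bool n → Bool) → Bool
allValuations zero    f = f []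
allValuations (suc n) f = allValuations n (f ∘ (true ∷_)) ∧ allValuations n (f ∘ (false ∷_))

allValuations-sound : ∀ n f → T (allValuations n f) → (v : Vec Bool n) → T (f v)
allValuations-sound zero    f holds [] = holds
allValuations-sound (suc n) f holds (true ∷ v) =
  allValuations-sound n (f ∘ (true ∷_)) (proj₁ (Equivalence.to T-∧ holds)) v
allValuations-sound (suc n) f holds (false ∷ v) =
  allValuations-sound n (f ∘ (false ∷_)) (proj₂ (Equivalence.to T-∧ holds)) v

isValid : Schema n → Bool
isValid {n} P = allValuations n ⟦ P ⟧ₚ

eval-⟨⟩ : ∀ a b (P : Schema n) ρ → eval a b (P ⟨ ρ ⟩) ≡ ⟦ P ⟧ₚ (map (eval a b) ρ)
eval-⟨⟩ a b (` i)    ρ = sym (lookup-map i (eval a b) ρ)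
eval-⟨⟩ a b ⊥ₚ       ρ = refl
eval-⟨⟩ a b (¬ₚ P)   ρ = cong not (eval-⟨⟩ a b P ρ)
eval-⟨⟩ a b (P ∧ₚ Q) ρ = cong₂ _∧_ (eval-⟨⟩ a b P ρ) (eval-⟨⟩ a b Q ρ)
eval-⟨⟩ a b (P ∨ₚ Q) ρ = cong₂ _∨_ (eval-⟨⟩ a b P ρ) (eval-⟨⟩ a b Q ρ)
eval-⟨⟩ a b (P ⇒ₚ Q) ρ = cong₂ _∨_ (cong not (eval-⟨⟩ a b P ρ)) (eval-⟨⟩ a b Q ρ)

valid⇒tautology : (P : Schema n) → T (isValid P) → (ρ : Vec Fm n) → Tautology (P ⟨ ρ ⟩)
valid⇒tautology P valid ρ a b =
  trans (eval-⟨⟩ a b P ρ) (Equivalence.to T-≡ (allValuations-sound _ ⟦ P ⟧ₚ valid (map (eval a b) ρ)))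

subst-◇^ : ∀ σ i φ → subst σ (◇^ i φ) ≡ ◇^ i (subst σ φ)
subst-◇^ σ zero    φ = refl
subst-◇^ σ (suc i) φ = cong ◇_ (subst-◇^ σ i φ)

subst-□^ : ∀ σ i φ → subst σ (□^ i φ) ≡ □^ i (subst σ φ)
subst-□^ σ zero    φ = refl
subst-□^ σ (suc i) φ = cong □_ (subst-□^ σ i φ)

subst-◇≤ : ∀ σ k φ → subst σ (◇≤ k φ) ≡ ◇≤ k (subst σ φ)
subst-◇≤ σ zero    φ = refl
subst-◇≤ σ (suc k) φ = cong₂ _∨'_ (subst-◇≤ σ k φ) (subst-◇^ σ (suc k) φ)

subst-□≤ : ∀ σ k φ → subst σ (□≤ k φ) ≡ □≤ k (subst σ φ)
subst-□≤ σ zero    φ = refl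
subst-□≤ σ (suc k) φ = cong₂ _∧'_ (subst-□≤ σ k φ) (subst-□^ σ (suc k) φ)

module NormalLogic {L : FmSet} (isL : IsLogic L) where
  private module ⊢ = IsLogic isL

  -- The validity proof is found by evaluation: T true is the unit type.
  tautology : (P : Schema n) {valid : T (isValid P)} (ρ : Vec Fm n) → L (P ⟨ ρ ⟩)
  tautology P {valid} ρ = ⊢.taut (valid⇒tautology P valid ρ)

  ⇒-elim : ∀ {A B} → L (A ⇒ B) → L A → L B
  ⇒-elim A⇒B a = ⊢.mp a A⇒B

  ⇒-elim₂ : ∀ {A B C} → L (A ⇒ B ⇒ C) → L A → L B → L C
  ⇒-elim₂ A⇒B⇒C a = ⇒-elim (⇒-elim A⇒B⇒C a)

  ⇒-refl : ∀ {A} → L (A ⇒ A)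
  ⇒-refl {A} = tautology (x₀ ⇒ₚ x₀) (A ∷ [])

  ⇒-trans : ∀ {A B C} → L (A ⇒ B) → L (B ⇒ C) → L (A ⇒ C)
  ⇒-trans {A} {B} {C} = ⇒-elim₂ (tautology ((x₀ ⇒ₚ x₁) ⇒ₚ (x₁ ⇒ₚ x₂) ⇒ₚ x₀ ⇒ₚ x₂) (A ∷ B ∷ C ∷ []))

  ⇒-preorder : Preorder _ _ _
  ⇒-preorder = record
    { Carrier    = Fm
    ; _≈_        = _≡_
    ; _≲_        = λ A B → L (A ⇒ B)
    ; isPreorder = record
      { isEquivalence = isEquivalence
      ; reflexive     = λ { refl → ⇒-refl }
      ; trans         = ⇒-trans
      }
    }

  module ⇒-Reasoning = PreorderReasoning ⇒-preorder

  ∧-intro : ∀ {A B} → L A → L B → L (A ∧' B)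
  ∧-intro {A} {B} = ⇒-elim₂ (tautology (x₀ ⇒ₚ x₁ ⇒ₚ x₀ ∧ₚ x₁) (A ∷ B ∷ []))

  ∧-map : ∀ {A A′ B B′} → L (A ⇒ A′) → L (B ⇒ B′) → L (A ∧' B ⇒ A′ ∧' B′)
  ∧-map {A} {A′} {B} {B′} =
    ⇒-elim₂ (tautology ((x₀ ⇒ₚ x₁) ⇒ₚ (x₂ ⇒ₚ x₃) ⇒ₚ x₀ ∧ₚ x₂ ⇒ₚ x₁ ∧ₚ x₃) (A ∷ A′ ∷ B ∷ B′ ∷ []))

  ∧-comm : ∀ {A B} → L (A ∧' B ⇒ B ∧' A)
  ∧-comm {A} {B} = tautology (x₀ ∧ₚ x₁ ⇒ₚ x₁ ∧ₚ x₀) (A ∷ B ∷ [])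

  ∨-introˡ : ∀ {A B} → L (A ⇒ A ∨' B)
  ∨-introˡ {A} {B} = tautology (x₀ ⇒ₚ x₀ ∨ₚ x₁) (A ∷ B ∷ [])

  ∨-introʳ : ∀ {A B} → L (B ⇒ A ∨' B)
  ∨-introʳ {A} {B} = tautology (x₁ ⇒ₚ x₀ ∨ₚ x₁) (A ∷ B ∷ [])

  ∨-elim : ∀ {A B C} → L (A ⇒ C) → L (B ⇒ C) → L (A ∨' B ⇒ C)
  ∨-elim {A} {B} {C} = ⇒-elim₂ (tautology ((x₀ ⇒ₚ x₂) ⇒ₚ (x₁ ⇒ₚ x₂) ⇒ₚ x₀ ∨ₚ x₁ ⇒ₚ x₂) (A ∷ B ∷ C ∷ []))

  ∨-map : ∀ {A A′ B B′} → L (A ⇒ A′) → L (B ⇒ B′) → L (A ∨' B ⇒ A′ ∨' B′)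
  ∨-map A⇒A′ B⇒B′ = ∨-elim (⇒-trans A⇒A′ ∨-introˡ) (⇒-trans B⇒B′ ∨-introʳ)

  contraposition : ∀ {A B} → L (A ⇒ B) → L (¬' B ⇒ ¬' A)
  contraposition {A} {B} = ⇒-elim (tautology ((x₀ ⇒ₚ x₁) ⇒ₚ ¬ₚ x₁ ⇒ₚ ¬ₚ x₀) (A ∷ B ∷ []))

  curry : ∀ {A B C} → L (A ∧' B ⇒ C) → L (A ⇒ B ⇒ C)
  curry {A} {B} {C} = ⇒-elim (tautology ((x₀ ∧ₚ x₁ ⇒ₚ x₂) ⇒ₚ x₀ ⇒ₚ x₁ ⇒ₚ x₂) (A ∷ B ∷ C ∷ []))

  excluded-middle : ∀ {A C} → L (A ⇒ C) → L (¬' A ⇒ C) → L C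
  excluded-middle {A} {C} = ⇒-elim₂ (tautology ((x₀ ⇒ₚ x₁) ⇒ₚ (¬ₚ x₀ ⇒ₚ x₁) ⇒ₚ x₁) (A ∷ C ∷ []))

  record IsNormalModality (□ₘ ◇ₘ : Fm → Fm) : Set where
    field
      ◇-mono : ∀ {A B} → L (A ⇒ B) → L (◇ₘ A ⇒ ◇ₘ B)
      ◇-⊥    : L (◇ₘ ⊥' ⇒ ⊥')
      ◇-∨    : ∀ {A B} → L (◇ₘ (A ∨' B) ⇒ ◇ₘ A ∨' ◇ₘ B)
      □⇒¬◇¬  : ∀ {A} → L (□ₘ A ⇒ ¬' ◇ₘ (¬' A))
      ¬◇¬⇒□  : ∀ {A} → L (¬' ◇ₘ (¬' A) ⇒ □ₘ A)

    open ⇒-Reasoning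

    ◇¬⇒¬□ : ∀ {A} → L (◇ₘ (¬' A) ⇒ ¬' □ₘ A)
    ◇¬⇒¬□ {A} = ⇒-elim (tautology ((x₀ ⇒ₚ ¬ₚ x₁) ⇒ₚ x₁ ⇒ₚ ¬ₚ x₀) (□ₘ A ∷ ◇ₘ (¬' A) ∷ [])) □⇒¬◇¬

    ¬□⇒◇¬ : ∀ {A} → L (¬' □ₘ A ⇒ ◇ₘ (¬' A))
    ¬□⇒◇¬ {A} = ⇒-elim (tautology ((¬ₚ x₁ ⇒ₚ x₀) ⇒ₚ ¬ₚ x₀ ⇒ₚ x₁) (□ₘ A ∷ ◇ₘ (¬' A) ∷ [])) ¬◇¬⇒□

    ¬◇⇒□¬ : ∀ {A} → L (¬' ◇ₘ A ⇒ □ₘ (¬' A))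
    ¬◇⇒□¬ {A} = ⇒-trans (contraposition (◇-mono (tautology (¬ₚ ¬ₚ x₀ ⇒ₚ x₀) (A ∷ [])))) ¬◇¬⇒□

    □-nec : ∀ {A} → L A → L (□ₘ A)
    □-nec {A} a = ⇒-elim ¬◇¬⇒□ (⇒-elim (tautology ((x₀ ⇒ₚ ⊥ₚ) ⇒ₚ ¬ₚ x₀) (◇ₘ (¬' A) ∷ [])) ◇¬A⇒⊥)
      where
      ◇¬A⇒⊥ : L (◇ₘ (¬' A) ⇒ ⊥')
      ◇¬A⇒⊥ = ⇒-trans (◇-mono (⇒-elim (tautology (x₀ ⇒ₚ ¬ₚ x₀ ⇒ₚ ⊥ₚ) (A ∷ [])) a)) ◇-⊥

    □-mono : ∀ {A B} → L (A ⇒ B) → L (□ₘ A ⇒ □ₘ B)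
    □-mono A⇒B = ⇒-trans □⇒¬◇¬ (⇒-trans (contraposition (◇-mono (contraposition A⇒B))) ¬◇¬⇒□)

    □-∧ : ∀ {A B} → L (□ₘ A ∧' □ₘ B ⇒ □ₘ (A ∧' B))
    □-∧ {A} {B} = ⇒-elim contrapose (begin
      ¬' □ₘ (A ∧' B)            ≲⟨ ¬□⇒◇¬ ⟩
      ◇ₘ (¬' (A ∧' B))          ≲⟨ ◇-mono de-Morgan ⟩
      ◇ₘ (¬' A ∨' ¬' B)         ≲⟨ ◇-∨ ⟩
      ◇ₘ (¬' A) ∨' ◇ₘ (¬' B)    ≲⟨ ∨-map ◇¬⇒¬□ ◇¬⇒¬□ ⟩
      ¬' □ₘ A ∨' ¬' □ₘ B        ∎)
      where
      de-Morgan : L (¬' (A ∧' B) ⇒ ¬' A ∨' ¬' B)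
      de-Morgan = tautology (¬ₚ (x₀ ∧ₚ x₁) ⇒ₚ ¬ₚ x₀ ∨ₚ ¬ₚ x₁) (A ∷ B ∷ [])
      contrapose : L ((¬' □ₘ (A ∧' B) ⇒ ¬' □ₘ A ∨' ¬' □ₘ B) ⇒ □ₘ A ∧' □ₘ B ⇒ □ₘ (A ∧' B))
      contrapose = tautology ((¬ₚ x₂ ⇒ₚ ¬ₚ x₀ ∨ₚ ¬ₚ x₁) ⇒ₚ x₀ ∧ₚ x₁ ⇒ₚ x₂) (□ₘ A ∷ □ₘ B ∷ □ₘ (A ∧' B) ∷ [])

    □-◇-K : ∀ {A B} → L (□ₘ A ∧' ◇ₘ B ⇒ ◇ₘ (A ∧' B))
    □-◇-K {A} {B} = ⇒-elim rearrange (begin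
      ◇ₘ B                      ≲⟨ ◇-mono (tautology (x₁ ⇒ₚ ¬ₚ x₀ ∨ₚ x₀ ∧ₚ x₁) (A ∷ B ∷ [])) ⟩
      ◇ₘ (¬' A ∨' A ∧' B)       ≲⟨ ◇-∨ ⟩
      ◇ₘ (¬' A) ∨' ◇ₘ (A ∧' B)  ≲⟨ ∨-map ◇¬⇒¬□ ⇒-refl ⟩
      ¬' □ₘ A ∨' ◇ₘ (A ∧' B)    ∎)
      where
      rearrange : L ((◇ₘ B ⇒ ¬' □ₘ A ∨' ◇ₘ (A ∧' B)) ⇒ □ₘ A ∧' ◇ₘ B ⇒ ◇ₘ (A ∧' B))
      rearrange = tautology ((x₁ ⇒ₚ ¬ₚ x₀ ∨ₚ x₂) ⇒ₚ x₀ ∧ₚ x₁ ⇒ₚ x₂) (□ₘ A ∷ ◇ₘ B ∷ ◇ₘ (A ∧' B) ∷ [])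

    ◇-□-K : ∀ {A B} → L (◇ₘ A ∧' □ₘ B ⇒ ◇ₘ (A ∧' B))
    ◇-□-K = ⇒-trans ∧-comm (⇒-trans □-◇-K (◇-mono ∧-comm))

    □-◇-⇒ : ∀ {A B} → L (□ₘ (A ⇒ B) ⇒ ◇ₘ A ⇒ ◇ₘ B)
    □-◇-⇒ {A} {B} = curry (⇒-trans □-◇-K (◇-mono (tautology ((x₀ ⇒ₚ x₁) ∧ₚ x₀ ⇒ₚ x₁) (A ∷ B ∷ []))))

  □◇-normal : IsNormalModality □_ ◇_
  □◇-normal = record
    { ◇-mono = ⊢.mono
    ; ◇-⊥    = ⇒-elim (tautology (¬ₚ x₀ ⇒ₚ x₀ ⇒ₚ ⊥ₚ) (◇ ⊥' ∷ [])) ⊢.dia⊥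
    ; ◇-∨    = λ {A} {B} → ⊢.sub (λ { zero → A ; (suc _) → B }) ⊢.dia∨
    ; □⇒¬◇¬  = ⇒-refl
    ; ¬◇¬⇒□  = ⇒-refl
    }

  id-normal : IsNormalModality id id
  id-normal = record
    { ◇-mono = id
    ; ◇-⊥    = ⇒-refl
    ; ◇-∨    = ⇒-refl
    ; □⇒¬◇¬  = λ {A} → tautology (x₀ ⇒ₚ ¬ₚ ¬ₚ x₀) (A ∷ [])
    ; ¬◇¬⇒□  = λ {A} → tautology (¬ₚ ¬ₚ x₀ ⇒ₚ x₀) (A ∷ [])
    }

  ∘-normal : ∀ {□₁ ◇₁ □₂ ◇₂} → IsNormalModality □₁ ◇₁ → IsNormalModality □₂ ◇₂ →
             IsNormalModality (□₁ ∘ □₂) (◇₁ ∘ ◇₂)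
  ∘-normal M₁ M₂ = record
    { ◇-mono = M₁.◇-mono ∘ M₂.◇-mono
    ; ◇-⊥    = ⇒-trans (M₁.◇-mono M₂.◇-⊥) M₁.◇-⊥
    ; ◇-∨    = ⇒-trans (M₁.◇-mono M₂.◇-∨) M₁.◇-∨
    ; □⇒¬◇¬  = ⇒-trans M₁.□⇒¬◇¬ (contraposition (M₁.◇-mono M₂.◇¬⇒¬□))
    ; ¬◇¬⇒□  = ⇒-trans (contraposition (M₁.◇-mono M₂.¬□⇒◇¬)) M₁.¬◇¬⇒□
    }
    where
    module M₁ = IsNormalModality M₁
    module M₂ = IsNormalModality M₂

  ∧∨-normal : ∀ {□₁ ◇₁ □₂ ◇₂} → IsNormalModality □₁ ◇₁ → IsNormalModality □₂ ◇₂ →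
              IsNormalModality (λ A → □₁ A ∧' □₂ A) (λ A → ◇₁ A ∨' ◇₂ A)
  ∧∨-normal {□₁} {◇₁} {□₂} {◇₂} M₁ M₂ = record
    { ◇-mono = λ A⇒B → ∨-map (M₁.◇-mono A⇒B) (M₂.◇-mono A⇒B)
    ; ◇-⊥    = ∨-elim M₁.◇-⊥ M₂.◇-⊥
    ; ◇-∨    = λ {A} {B} → ⇒-trans (∨-map M₁.◇-∨ M₂.◇-∨)
        (tautology ((x₀ ∨ₚ x₁) ∨ₚ (x₂ ∨ₚ x₃) ⇒ₚ (x₀ ∨ₚ x₂) ∨ₚ (x₁ ∨ₚ x₃)) (◇₁ A ∷ ◇₁ B ∷ ◇₂ A ∷ ◇₂ B ∷ []))
    ; □⇒¬◇¬  = λ {A} → ⇒-trans (∧-map M₁.□⇒¬◇¬ M₂.□⇒¬◇¬)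
        (tautology (¬ₚ x₀ ∧ₚ ¬ₚ x₁ ⇒ₚ ¬ₚ (x₀ ∨ₚ x₁)) (◇₁ (¬' A) ∷ ◇₂ (¬' A) ∷ []))
    ; ¬◇¬⇒□  = λ {A} → ⇒-trans
        (tautology (¬ₚ (x₀ ∨ₚ x₁) ⇒ₚ ¬ₚ x₀ ∧ₚ ¬ₚ x₁) (◇₁ (¬' A) ∷ ◇₂ (¬' A) ∷ [])) (∧-map M₁.¬◇¬⇒□ M₂.¬◇¬⇒□)
    }
    where
    module M₁ = IsNormalModality M₁
    module M₂ = IsNormalModality M₂

  □^◇^-normal : ∀ i → IsNormalModality (□^ i) (◇^ i)
  □^◇^-normal zero    = id-normal
  □^◇^-normal (suc i) = ∘-normal □◇-normal (□^◇^-normal i)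

  □≤◇≤-normal : ∀ k → IsNormalModality (□≤ k) (◇≤ k)
  □≤◇≤-normal zero    = id-normal
  □≤◇≤-normal (suc k) = ∧∨-normal (□≤◇≤-normal k) (□^◇^-normal (suc k))

  □-antitone : ∀ {□₁ ◇₁ □₂ ◇₂} → IsNormalModality □₁ ◇₁ → IsNormalModality □₂ ◇₂ →
               (∀ {A} → L (◇₁ A ⇒ ◇₂ A)) → ∀ {A} → L (□₂ A ⇒ □₁ A)
  □-antitone M₁ M₂ ◇₁⇒◇₂ = ⇒-trans M₂.□⇒¬◇¬ (⇒-trans (contraposition ◇₁⇒◇₂) M₁.¬◇¬⇒□)
    where
    module M₁ = IsNormalModality M₁
    module M₂ = IsNormalModality M₂

  private module Base = IsNormalModality □◇-normal

  ◇≤-intro : ∀ k {A} → L (A ⇒ ◇≤ k A)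
  ◇≤-intro zero    = ⇒-refl
  ◇≤-intro (suc k) = ⇒-trans (◇≤-intro k) ∨-introˡ

  ◇-◇≤ : ∀ k {A} → L (◇ (◇≤ k A) ⇒ ◇≤ (suc k) A)
  ◇-◇≤ zero    = ∨-introʳ
  ◇-◇≤ (suc k) = ⇒-trans Base.◇-∨ (∨-map (◇-◇≤ k) ⇒-refl)

  ◇^-closed : ∀ {C} → L (◇ C ⇒ C) → ∀ i → L (◇^ i C ⇒ C)
  ◇^-closed ◇C⇒C zero    = ⇒-refl
  ◇^-closed ◇C⇒C (suc i) = ⇒-trans (Base.◇-mono (◇^-closed ◇C⇒C i)) ◇C⇒C

  ◇≤-closed : ∀ {C} → L (◇ C ⇒ C) → ∀ k → L (◇≤ k C ⇒ C)
  ◇≤-closed ◇C⇒C zero    = ⇒-refl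
  ◇≤-closed ◇C⇒C (suc k) = ∨-elim (◇≤-closed ◇C⇒C k) (◇^-closed ◇C⇒C (suc k))

module Pretransitive {L : FmSet} (isL : IsLogic L) {m : ℕ} (pt : L (PT m)) where
  open NormalLogic isL
  open ⇒-Reasoning
  private module ⊢ = IsLogic isL

  ◇* □* : Fm → Fm
  ◇* = ◇≤ m
  □* = □≤ m

  private
    module Base   = IsNormalModality □◇-normal
    module Master = IsNormalModality (□≤◇≤-normal m)

  pretransitivity : ∀ {A} → L (◇^ (suc m) A ⇒ ◇* A)
  pretransitivity {A} =
    ≡-subst L (cong₂ _⇒_ (subst-◇^ (λ _ → A) (suc m) p₁) (subst-◇≤ (λ _ → A) m p₁)) (⊢.sub (λ _ → A) pt)

  B₁-instance : L (B 1 m) → ∀ A → L (A ⇒ □* (◇* A))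
  B₁-instance b₁ A =
    ≡-subst L (cong (A ⇒_) (trans (subst-□≤ (λ _ → A) m (◇≤ m p₁)) (cong □* (subst-◇≤ (λ _ → A) m p₁))))
      (⊢.sub (λ _ → A) b₁)

  ◇◇*⇒◇* : ∀ {A} → L (◇ (◇* A) ⇒ ◇* A)
  ◇◇*⇒◇* = ⇒-trans (◇-◇≤ m) (∨-elim ⇒-refl pretransitivity)

  ◇*◇*⇒◇* : ∀ {A} → L (◇* (◇* A) ⇒ ◇* A)
  ◇*◇*⇒◇* = ◇≤-closed ◇◇*⇒◇* m

  ◇⇒◇* : ∀ {A} → L (◇ A ⇒ ◇* A)
  ◇⇒◇* = ⇒-trans (Base.◇-mono (◇≤-intro m)) ◇◇*⇒◇*

  □*⇒□*□* : ∀ {A} → L (□* A ⇒ □* (□* A))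
  □*⇒□*□* = □-antitone (∘-normal (□≤◇≤-normal m) (□≤◇≤-normal m)) (□≤◇≤-normal m) ◇*◇*⇒◇*

  □*⇒□ : ∀ {A} → L (□* A ⇒ □ A)
  □*⇒□ = □-antitone □◇-normal (□≤◇≤-normal m) ◇⇒◇*

  ◇*□*-intro : ∀ {A} → L A → L (◇* (□* A))
  ◇*□*-intro a = ⇒-elim (◇≤-intro m) (Master.□-nec a)

  ◇*□*-mp : ∀ {A B} → L (◇* (□* A)) → L (◇* (□* (A ⇒ B))) → L (◇* (□* B))
  ◇*□*-mp {A} {B} ◇□A ◇□[A⇒B] = ⇒-elim chain (∧-intro ◇□A (Master.□-nec ◇□[A⇒B]))
    where
    chain : L (◇* (□* A) ∧' □* (◇* (□* (A ⇒ B))) ⇒ ◇* (□* B))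
    chain = begin
      ◇* (□* A) ∧' □* (◇* (□* (A ⇒ B)))   ≲⟨ Master.◇-□-K ⟩
      ◇* (□* A ∧' ◇* (□* (A ⇒ B)))        ≲⟨ Master.◇-mono (∧-map □*⇒□*□* ⇒-refl) ⟩
      ◇* (□* (□* A) ∧' ◇* (□* (A ⇒ B)))   ≲⟨ Master.◇-mono Master.□-◇-K ⟩
      ◇* (◇* (□* A ∧' □* (A ⇒ B)))        ≲⟨ ◇*◇*⇒◇* ⟩
      ◇* (□* A ∧' □* (A ⇒ B))             ≲⟨ Master.◇-mono Master.□-∧ ⟩
      ◇* (□* (A ∧' (A ⇒ B)))              ≲⟨ Master.◇-mono (Master.□-mono modus-ponens) ⟩
      ◇* (□* B)                           ∎
      where
      modus-ponens : L (A ∧' (A ⇒ B) ⇒ B)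
      modus-ponens = tautology (x₀ ∧ₚ (x₀ ⇒ₚ x₁) ⇒ₚ x₁) (A ∷ B ∷ [])

  ◇*□*-mono : ∀ {A B} → L (◇* (□* (A ⇒ B))) → L (◇* (□* (◇ A ⇒ ◇ B)))
  ◇*□*-mono {A} {B} = ⇒-elim (Master.◇-mono (begin
    □* (A ⇒ B)        ≲⟨ □*⇒□*□* ⟩
    □* (□* (A ⇒ B))   ≲⟨ Master.□-mono □*⇒□ ⟩
    □* (□ (A ⇒ B))    ≲⟨ Master.□-mono Base.□-◇-⇒ ⟩
    □* (◇ A ⇒ ◇ B)    ∎))

  ◇*□*-subst : ∀ {A} σ → L (◇* (□* A)) → L (◇* (□* (subst σ A)))
  ◇*□*-subst {A} σ ◇□A =
    ≡-subst L (trans (subst-◇≤ σ m (□* A)) (cong ◇* (subst-□≤ σ m A))) (⊢.sub σ ◇□A)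

  ◇*□*-B₁ : ∀ {A} → L (◇* (□* (A ⇒ □* (◇* A))))
  ◇*□*-B₁ {A} = excluded-middle □*◇*A-case ¬□*◇*A-case
    where
    □*◇*A-case : L (□* (◇* A) ⇒ ◇* (□* (A ⇒ □* (◇* A))))
    □*◇*A-case = begin
      □* (◇* A)                 ≲⟨ □*⇒□*□* ⟩
      □* (□* (◇* A))            ≲⟨ Master.□-mono (tautology (x₁ ⇒ₚ x₀ ⇒ₚ x₁) (A ∷ □* (◇* A) ∷ [])) ⟩
      □* (A ⇒ □* (◇* A))        ≲⟨ ◇≤-intro m ⟩
      ◇* (□* (A ⇒ □* (◇* A)))   ∎
    ¬□*◇*A-case : L (¬' □* (◇* A) ⇒ ◇* (□* (A ⇒ □* (◇* A))))
    ¬□*◇*A-case = begin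
      ¬' □* (◇* A)              ≲⟨ Master.¬□⇒◇¬ ⟩
      ◇* (¬' ◇* A)              ≲⟨ Master.◇-mono Master.¬◇⇒□¬ ⟩
      ◇* (□* (¬' A))            ≲⟨ Master.◇-mono (Master.□-mono ex-falso) ⟩
      ◇* (□* (A ⇒ □* (◇* A)))   ∎
      where
      ex-falso : L (¬' A ⇒ A ⇒ □* (◇* A))
      ex-falso = tautology (¬ₚ x₀ ⇒ₚ x₀ ⇒ₚ x₁) (A ∷ □* (◇* A) ∷ [])

  [1]⊆◇*□* : ∀ {A} → (L [ 1 ]at m) A → L (◇* (□* A))
  [1]⊆◇*□* (inL a)      = ◇*□*-intro a
  [1]⊆◇*□* (inΦ refl)   = ◇*□*-B₁
  [1]⊆◇*□* (taut t)     = ◇*□*-intro (⊢.taut t)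
  [1]⊆◇*□* dia⊥         = ◇*□*-intro ⊢.dia⊥
  [1]⊆◇*□* dia∨         = ◇*□*-intro ⊢.dia∨
  [1]⊆◇*□* (mp a a⇒b)   = ◇*□*-mp ([1]⊆◇*□* a) ([1]⊆◇*□* a⇒b)
  [1]⊆◇*□* (sub σ a)    = ◇*□*-subst σ ([1]⊆◇*□* a)
  [1]⊆◇*□* (mono a⇒b)   = ◇*□*-mono ([1]⊆◇*□* a⇒b)

  ◇*□*-elim : L (B 1 m) → ∀ {A} → L (◇* (□* A)) → L A
  ◇*□*-elim b₁ {A} ◇□A = ⇒-elim (⇒-elim₂ reductio (B₁-instance b₁ (¬' A)) incompatible) ◇□A
    where
    reductio : L ((¬' A ⇒ □* (◇* (¬' A))) ⇒ (◇* (□* A) ∧' □* (◇* (¬' A)) ⇒ ⊥') ⇒ ◇* (□* A) ⇒ A)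
    reductio = tautology ((¬ₚ x₀ ⇒ₚ x₁) ⇒ₚ (x₂ ∧ₚ x₁ ⇒ₚ ⊥ₚ) ⇒ₚ x₂ ⇒ₚ x₀)
                         (A ∷ □* (◇* (¬' A)) ∷ ◇* (□* A) ∷ [])
    incompatible : L (◇* (□* A) ∧' □* (◇* (¬' A)) ⇒ ⊥')
    incompatible = begin
      ◇* (□* A) ∧' □* (◇* (¬' A))   ≲⟨ Master.◇-□-K ⟩
      ◇* (□* A ∧' ◇* (¬' A))        ≲⟨ Master.◇-mono Master.□-◇-K ⟩
      ◇* (◇* (A ∧' ¬' A))           ≲⟨ ◇*◇*⇒◇* ⟩
      ◇* (A ∧' ¬' A)                ≲⟨ Master.◇-mono (tautology (x₀ ∧ₚ ¬ₚ x₀ ⇒ₚ ⊥ₚ) (A ∷ [])) ⟩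
      ◇* ⊥'                         ≲⟨ Master.◇-⊥ ⟩
      ⊥'                            ∎

⊕-isLogic : ∀ {L Φ} → IsLogic (L ⊕ Φ)
⊕-isLogic = record { taut = taut ; dia⊥ = dia⊥ ; dia∨ = dia∨ ; mp = mp ; sub = sub ; mono = mono }

theorem3 : (L : FmSet) → IsLogic L → (m : ℕ) → IsTr L m →
           (φ : Fm) →
           (((L [ 1 ]at m) φ → L (◇≤ m (□≤ m φ))) × (L (◇≤ m (□≤ m φ)) → (L [ 1 ]at m) φ))
theorem3 L isL m (pt , _) φ = Pretransitive.[1]⊆◇*□* isL pt , ◇*□*⇒[1]
  where
  ◇*□*⇒[1] : L (◇≤ m (□≤ m φ)) → (L [ 1 ]at m) φ
  ◇*□*⇒[1] ◇□φ = Pretransitive.◇*□*-elim ⊕-isLogic (inL pt) (inΦ refl) (inL ◇□φ)
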